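{- Let $c(n)$, for integers $n\geq -1$, be defined by $$\frac{1}{q}\prod_{m=1}^{\infty}\frac{(1-q^{m})^{24}}{(1-q^{2m})^{24}}=\sum_{n=-1}^{\infty}c(n)q^{n}.$$ Then $c(n)\neq 0$ for every integer $n\geq -1$.
   Context: This $q$-series is the expansion of $\eta^{24}(\tau)/\eta^{24}(2\tau)$, where $\eta$ is the Dedekind eta function and $q=e^{2\pi i\tau}$. -}

module Defs where

open import Data.Nat as ℕ using (ℕ; zero; suc; _∸_)
open import Data.Nat.Divisibility using (_∣?_)
open import Data.Integer as ℤ using (ℤ; +_; -_; ∣_∣)
open import Relation.Nullary.Decidable using (does)
open import Data.Bool using (if_then_else_)

-- Formal power series in q with integer coefficients: n ↦ coefficient of q^n.
Series : Set
Series = ℕ → ℤ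

sumTo : ℕ → (ℕ → ℤ) → ℤ
sumTo zero    f = f zero
sumTo (suc n) f = sumTo n f ℤ.+ f (suc n)

_⊛_ : Series → Series → Series
(f ⊛ g) n = sumTo n (λ i → f i ℤ.* g (n ∸ i))

infixl 7 _⊛_

one : Series
one zero    = + 1
one (suc _) = + 0

_^ˢ_ : Series → ℕ → Series
f ^ˢ zero  = one
f ^ˢ suc k = f ⊛ (f ^ˢ k)

oneMinusQ : ℕ → Series
oneMinusQ d n =
  (if does (n ℕ.≟ 0) then + 1 else + 0) ℤ.- (if does (n ℕ.≟ d) then + 1 else + 0)

-- the formal inverse (1 - q^d)^{-1} = Σ_{j≥0} q^{dj}   (d ≥ 1)
invOneMinusQ : ℕ → Series
invOneMinusQ d n = if does (d ∣? n) then + 1 else + 0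

factor : ℕ → Series
factor m = (oneMinusQ m ^ˢ 24) ⊛ (invOneMinusQ (2 ℕ.* m) ^ˢ 24)

prodUpTo : ℕ → Series
prodUpTo zero    = one
prodUpTo (suc N) = prodUpTo N ⊛ factor (suc N)

-- Coefficient of q^k in the infinite product ∏_{m≥1} factor m.
-- Every factor with m > k is ≡ 1 mod q^{k+1}, so this coefficient equals
-- that of the finite product over 1 ≤ m ≤ k.
prodCoeff : ℕ → ℤ
prodCoeff k = prodUpTo k k

-- c(n) for n ≥ -1: coefficient of q^n in q^{-1} ∏ ..., i.e. the
-- coefficient of q^{n+1} in the product.
c : ℤ → ℤ
c n = prodCoeff ∣ n ℤ.+ + 1 ∣

module Submission where

-- By Euler, (1 - q^m)/(1 - q^{2m}) = 1/(1 + q^m) and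
-- ∏_m 1/(1 + q^m) = ∏_j (1 - q^{2j+1}).  Substituting q ↦ -q turns the
-- product into G^24 with G = ∏_j (1 + q^{2j+1}), a series with non-negative
-- coefficients whose constant term and odd coefficients are all ≥ 1.  Then
-- every coefficient of G² is ≥ 1 (an even exponent 2j+2 is 1 + (2j+1), an
-- odd one is 0 + odd), hence so is every coefficient of G^24, and the
-- coefficients of the original series are those of G^24 up to the sign (-1)^n.
--
-- Everything is done with finite products.  The coefficient of q^N only
-- involves factors with m ≤ N; for those, the exact identity
--   ∏_{m≤N} (1-q^m)/(1-q^{2m}) = ∏_{j<K} (1-q^{2j+1}) · ∏_{N/2<m≤N} 1/(1-q^{2m})
-- (with N ≤ 2K) holds, and the remaining product is unchanged by q ↦ -q and
-- also has non-negative coefficients and constant term 1.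

open import Defs
open import Data.Integer using (ℤ; _≤_; -_; +_)
open import Relation.Binary.PropositionalEquality using (_≢_)

open import Data.Nat as ℕ using (ℕ; zero; suc; _∸_; z≤n; s≤s)
import Data.Nat.Properties as ℕP
import Data.Nat.Divisibility as ℕD
open import Data.Nat.Divisibility using (_∣?_; divides)
open import Data.Integer as ℤ using (_+_; _*_; _-_; _^_; +≤+; -1ℤ)
import Data.Integer.Properties as ℤP
open import Data.Integer.Tactic.RingSolver using (solve-∀)
open import Relation.Binary.PropositionalEquality
  using (_≡_; refl; sym; trans; cong; cong₂; subst; subst₂; module ≡-Reasoning)
open import Relation.Binary.Bundles using (Setoid)
import Relation.Binary.Reasoning.Setoid as SetoidReasoning
open import Relation.Nullary.Decidable using (does; yes; no; dec-true; dec-false)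
open import Relation.Nullary.Negation using (¬_; contradiction)
open import Data.Bool using (true; false; if_then_else_)
open import Data.Sum using (_⊎_; inj₁; inj₂)
open import Function using (_∘_)
open import Data.Product using (∃; _×_; _,_)
open import Algebra.Bundles using (CommutativeMonoid)
import Algebra.Solver.CommutativeMonoid as CMSolver
open import Data.Fin using (zero; suc)
open import Data.Vec using ([]; _∷_)

sumTo-cong : ∀ n {f g : ℕ → ℤ} → (∀ i → i ℕ.≤ n → f i ≡ g i) → sumTo n f ≡ sumTo n g
sumTo-cong zero    f≡g = f≡g 0 z≤n
sumTo-cong (suc n) f≡g =
  cong₂ _+_ (sumTo-cong n (λ i i≤n → f≡g i (ℕP.m≤n⇒m≤1+n i≤n))) (f≡g (suc n) ℕP.≤-refl)

sumTo-zero : ∀ n {f : ℕ → ℤ} → (∀ i → i ℕ.≤ n → f i ≡ + 0) → sumTo n f ≡ + 0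
sumTo-zero n f≡0 = trans (sumTo-cong n f≡0) (const0 n)
  where
  const0 : ∀ m → sumTo m (λ _ → + 0) ≡ + 0
  const0 zero    = refl
  const0 (suc m) = cong (_+ + 0) (const0 m)

sumTo-+ : ∀ n (f g : ℕ → ℤ) → sumTo n (λ i → f i + g i) ≡ sumTo n f + sumTo n g
sumTo-+ zero    f g = refl
sumTo-+ (suc n) f g = trans (cong (_+ (f (suc n) + g (suc n))) (sumTo-+ n f g))
                            (swap (sumTo n f) (sumTo n g) (f (suc n)) (g (suc n)))
  where
  swap : ∀ a b c d → a + b + (c + d) ≡ a + c + (b + d)
  swap = solve-∀

sumTo-*ˡ : ∀ n a (f : ℕ → ℤ) → a * sumTo n f ≡ sumTo n (λ i → a * f i)
sumTo-*ˡ zero    a f = refl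
sumTo-*ˡ (suc n) a f = trans (ℤP.*-distribˡ-+ a (sumTo n f) (f (suc n)))
                             (cong (_+ a * f (suc n)) (sumTo-*ˡ n a f))

sumTo-- : ∀ n (f g : ℕ → ℤ) → sumTo n (λ i → f i - g i) ≡ sumTo n f - sumTo n g
sumTo-- n f g = trans (sumTo-+ n f (λ i → - g i)) (cong (λ z → sumTo n f + z) (sym (negate n)))
  where
  negate : ∀ m → - sumTo m g ≡ sumTo m (λ i → - g i)
  negate zero    = refl
  negate (suc m) = trans (ℤP.neg-distrib-+ (sumTo m g) (g (suc m))) (cong (_+ - g (suc m)) (negate m))

sumTo-head : ∀ n (g : ℕ → ℤ) → sumTo (suc n) g ≡ g 0 + sumTo n (λ i → g (suc i))
sumTo-head zero    g = refl
sumTo-head (suc n) g = trans (cong (_+ g (suc (suc n))) (sumTo-head n g)) (ℤP.+-assoc (g 0) _ _)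

sumTo-reverse : ∀ n (f : ℕ → ℤ) → sumTo n f ≡ sumTo n (λ i → f (n ∸ i))
sumTo-reverse zero    f = refl
sumTo-reverse (suc n) f = sym (begin
  sumTo (suc n) (λ i → f (suc n ∸ i))     ≡⟨ sumTo-head n _ ⟩
  f (suc n) + sumTo n (λ i → f (n ∸ i))   ≡⟨ cong (λ z → f (suc n) + z) (sym (sumTo-reverse n f)) ⟩
  f (suc n) + sumTo n f                   ≡⟨ ℤP.+-comm (f (suc n)) _ ⟩
  sumTo (suc n) f                         ∎)
  where open ≡-Reasoning

sumTo-triangle : ∀ n (F : ℕ → ℕ → ℤ) →
  sumTo n (λ i → sumTo (n ∸ i) (F i)) ≡ sumTo n (λ s → sumTo s (λ i → F i (s ∸ i)))
sumTo-triangle zero    F = refl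
sumTo-triangle (suc n) F = begin
  sumTo n (λ i → sumTo (suc n ∸ i) (F i)) + sumTo (n ∸ n) (F (suc n))
    ≡⟨ cong₂ _+_ (sumTo-cong n (λ i i≤n → cong (λ k → sumTo k (F i)) (ℕP.+-∸-assoc 1 i≤n)))
                 (cong (λ k → sumTo k (F (suc n))) (ℕP.n∸n≡0 n)) ⟩
  sumTo n (λ i → sumTo (n ∸ i) (F i) + F i (suc (n ∸ i))) + F (suc n) 0
    ≡⟨ cong (_+ F (suc n) 0) (sumTo-+ n _ _) ⟩
  sumTo n (λ i → sumTo (n ∸ i) (F i)) + sumTo n (λ i → F i (suc (n ∸ i))) + F (suc n) 0
    ≡⟨ ℤP.+-assoc (sumTo n (λ i → sumTo (n ∸ i) (F i))) _ _ ⟩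
  sumTo n (λ i → sumTo (n ∸ i) (F i)) + (sumTo n (λ i → F i (suc (n ∸ i))) + F (suc n) 0)
    ≡⟨ cong₂ _+_ (sumTo-triangle n F)
                 (cong₂ _+_ (sumTo-cong n (λ i i≤n → cong (F i) (sym (ℕP.+-∸-assoc 1 i≤n))))
                            (cong (F (suc n)) (sym (ℕP.n∸n≡0 n)))) ⟩
  sumTo n (λ s → sumTo s (λ i → F i (s ∸ i))) + sumTo (suc n) (λ i → F i (suc n ∸ i)) ∎
  where open ≡-Reasoning

-- Coefficientwise equality of series.  (A record, so that the two series
-- can be inferred from a proof.)
infix 4 _≈_
record _≈_ (f g : Series) : Set where
  constructor coeffwise
  field app : ∀ n → f n ≡ g n
open _≈_ public

seriesSetoid : Setoid _ _
seriesSetoid = record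
  { Carrier       = Series
  ; _≈_           = _≈_
  ; isEquivalence = record
    { refl  = coeffwise λ _ → refl
    ; sym   = λ f≈g → coeffwise λ n → sym (app f≈g n)
    ; trans = λ f≈g g≈h → coeffwise λ n → trans (app f≈g n) (app g≈h n) } }

open Setoid seriesSetoid public using () renaming (refl to ≈-refl; sym to ≈-sym; trans to ≈-trans)
module ≈-Reasoning = SetoidReasoning seriesSetoid

≡⇒≈ : ∀ {f g} → f ≡ g → f ≈ g
≡⇒≈ refl = ≈-refl

⊛-cong : ∀ {f f′ g g′} → f ≈ f′ → g ≈ g′ → f ⊛ g ≈ f′ ⊛ g′
⊛-cong f≈f′ g≈g′ = coeffwise λ n →
  sumTo-cong n (λ i _ → cong₂ _*_ (app f≈f′ i) (app g≈g′ (n ∸ i)))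

⊛-comm : ∀ f g → f ⊛ g ≈ g ⊛ f
⊛-comm f g = coeffwise λ n → trans (sumTo-reverse n _) (sumTo-cong n (λ i i≤n →
  trans (cong (λ k → f (n ∸ i) * g k) (ℕP.m∸[m∸n]≡n i≤n)) (ℤP.*-comm (f (n ∸ i)) (g i))))

⊛-identityˡ : ∀ g → one ⊛ g ≈ g
⊛-identityˡ g = coeffwise unit
  where
  unit : ∀ n → (one ⊛ g) n ≡ g n
  unit zero    = ℤP.*-identityˡ (g 0)
  unit (suc n) = begin
    (one ⊛ g) (suc n)                                 ≡⟨ sumTo-head n _ ⟩
    + 1 * g (suc n) + sumTo n (λ i → + 0 * g (n ∸ i)) ≡⟨ cong₂ _+_ (ℤP.*-identityˡ (g (suc n)))
                                                               (sumTo-zero n (λ i _ → ℤP.*-zeroˡ (g (n ∸ i)))) ⟩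
    g (suc n) + + 0                                   ≡⟨ ℤP.+-identityʳ _ ⟩
    g (suc n)                                         ∎
    where open ≡-Reasoning

⊛-identityʳ : ∀ g → g ⊛ one ≈ g
⊛-identityʳ g = ≈-trans (⊛-comm g one) (⊛-identityˡ g)

-- Associativity: both sides are the sum of f i g j h k over i + j + k = n.
⊛-assoc : ∀ f g h → (f ⊛ g) ⊛ h ≈ f ⊛ (g ⊛ h)
⊛-assoc f g h = coeffwise λ n → begin
  sumTo n (λ s → sumTo s (λ i → f i * g (s ∸ i)) * h (n ∸ s))
    ≡⟨ sumTo-cong n (λ s s≤n → expand n s s≤n) ⟩
  sumTo n (λ s → sumTo s (λ i → F n i (s ∸ i)))
    ≡⟨ sym (sumTo-triangle n (F n)) ⟩
  sumTo n (λ i → sumTo (n ∸ i) (F n i))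
    ≡⟨ sumTo-cong n (λ i _ → sym (sumTo-*ˡ (n ∸ i) (f i) _)) ⟩
  sumTo n (λ i → f i * (g ⊛ h) (n ∸ i)) ∎
  where
  open ≡-Reasoning
  F : ℕ → ℕ → ℕ → ℤ
  F n i j = f i * (g j * h (n ∸ i ∸ j))
  expand : ∀ n s → s ℕ.≤ n →
    sumTo s (λ i → f i * g (s ∸ i)) * h (n ∸ s) ≡ sumTo s (λ i → F n i (s ∸ i))
  expand n s s≤n =
    trans (ℤP.*-comm (sumTo s _) (h (n ∸ s))) (trans (sumTo-*ˡ s (h (n ∸ s)) _) (sumTo-cong s λ i i≤s →
      trans (reassoc (h (n ∸ s)) (f i) (g (s ∸ i)))
            (cong (λ k → f i * (g (s ∸ i) * h k))
                  (sym (trans (ℕP.∸-+-assoc n i (s ∸ i)) (cong (n ∸_) (ℕP.m+[n∸m]≡n i≤s)))))))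
    where
    reassoc : ∀ a b c → a * (b * c) ≡ b * (c * a)
    reassoc = solve-∀

seriesMonoid : CommutativeMonoid _ _
seriesMonoid = record
  { Carrier = Series ; _≈_ = _≈_ ; _∙_ = _⊛_ ; ε = one
  ; isCommutativeMonoid = record
    { isMonoid = record
      { isSemigroup = record
        { isMagma = record { isEquivalence = Setoid.isEquivalence seriesSetoid ; ∙-cong = ⊛-cong }
        ; assoc   = ⊛-assoc }
      ; identity = ⊛-identityˡ , ⊛-identityʳ }
    ; comm = ⊛-comm } }

open import Algebra.Properties.CommutativeMonoid.Mult seriesMonoid using (×-congʳ; ×-distrib-+)
  renaming (_×_ to _times_)
open import Algebra.Properties.CommutativeSemigroup
  (CommutativeMonoid.commutativeSemigroup seriesMonoid) using (interchange)
module ⊛-Solver = CMSolver seriesMonoid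

⊛-congˡ : ∀ {f f′} g → f ≈ f′ → f ⊛ g ≈ f′ ⊛ g
⊛-congˡ g f≈f′ = ⊛-cong f≈f′ (≈-refl {g})

⊛-congʳ : ∀ f {g g′} → g ≈ g′ → f ⊛ g ≈ f ⊛ g′
⊛-congʳ f g≈g′ = ⊛-cong (≈-refl {f}) g≈g′

-- Our powers are the monoid's iterated products  k times f,  so the
-- library's laws for those apply to them.
^ˢ-is-× : ∀ f k → f ^ˢ k ≡ k times f
^ˢ-is-× f zero    = refl
^ˢ-is-× f (suc k) = cong (f ⊛_) (^ˢ-is-× f k)

^ˢ-cong : ∀ {f g} k → f ≈ g → f ^ˢ k ≈ g ^ˢ k
^ˢ-cong {f} {g} k f≈g = subst₂ _≈_ (sym (^ˢ-is-× f k)) (sym (^ˢ-is-× g k)) (×-congʳ k f≈g)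

^ˢ-distrib-⊛ : ∀ f g k → (f ⊛ g) ^ˢ k ≈ (f ^ˢ k) ⊛ (g ^ˢ k)
^ˢ-distrib-⊛ f g k =
  subst₂ _≈_ (sym (^ˢ-is-× (f ⊛ g) k)) (sym (cong₂ _⊛_ (^ˢ-is-× f k) (^ˢ-is-× g k))) (×-distrib-+ f g k)

monomial : ℕ → Series
monomial a i = if does (i ℕ.≟ a) then + 1 else + 0

monomial-≢ : ∀ {a i} → i ≢ a → monomial a i ≡ + 0
monomial-≢ {a} {i} i≢a = cong (λ b → if b then + 1 else + 0) (dec-false (i ℕ.≟ a) i≢a)

monomial-≡ : ∀ a → monomial a a ≡ + 1
monomial-≡ a = cong (λ b → if b then + 1 else + 0) (dec-true (a ℕ.≟ a) refl)

sumTo-monomial-in : ∀ n a (G : ℕ → ℤ) → a ℕ.≤ n → sumTo n (λ i → monomial a i * G i) ≡ G a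
sumTo-monomial-out : ∀ n a (G : ℕ → ℤ) → n ℕ.< a → sumTo n (λ i → monomial a i * G i) ≡ + 0

sumTo-monomial-out n a G n<a = sumTo-zero n λ i i≤n →
  trans (cong (_* G i) (monomial-≢ (ℕP.<⇒≢ (ℕP.≤-<-trans i≤n n<a)))) (ℤP.*-zeroˡ (G i))

sumTo-monomial-in zero    .zero G z≤n = ℤP.*-identityˡ (G 0)
sumTo-monomial-in (suc n) a     G a≤1+n with ℕP.m≤n⇒m<n∨m≡n a≤1+n
... | inj₁ a<1+n = begin
  sumTo n (λ i → monomial a i * G i) + monomial a (suc n) * G (suc n)
    ≡⟨ cong₂ _+_ (sumTo-monomial-in n a G (ℕP.≤-pred a<1+n))
                 (cong (_* G (suc n)) (monomial-≢ (ℕP.<⇒≢ a<1+n ∘ sym))) ⟩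
  G a + + 0 * G (suc n)
    ≡⟨ ℤP.+-identityʳ (G a) ⟩
  G a ∎
  where open ≡-Reasoning
... | inj₂ refl = begin
  sumTo n (λ i → monomial a i * G i) + monomial a a * G a
    ≡⟨ cong₂ _+_ (sumTo-monomial-out n a G ℕP.≤-refl) (cong (_* G a) (monomial-≡ a)) ⟩
  + 0 + + 1 * G a
    ≡⟨ trans (ℤP.+-identityˡ _) (ℤP.*-identityˡ (G a)) ⟩
  G a ∎
  where open ≡-Reasoning

oneMinusQ-⊛ : ∀ d g n → (oneMinusQ d ⊛ g) n
  ≡ sumTo n (λ i → monomial 0 i * g (n ∸ i)) - sumTo n (λ i → monomial d i * g (n ∸ i))
oneMinusQ-⊛ d g n =
  trans (sumTo-cong n (λ i _ → distrib (monomial 0 i) (monomial d i) (g (n ∸ i)))) (sumTo-- n _ _)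
  where
  distrib : ∀ x y z → (x - y) * z ≡ x * z - y * z
  distrib = solve-∀

oneMinusQ-⊛-≥ : ∀ d g n → d ℕ.≤ n → (oneMinusQ d ⊛ g) n ≡ g n - g (n ∸ d)
oneMinusQ-⊛-≥ d g n d≤n =
  trans (oneMinusQ-⊛ d g n) (cong₂ _-_ (sumTo-monomial-in n 0 (λ i → g (n ∸ i)) z≤n)
                                       (sumTo-monomial-in n d (λ i → g (n ∸ i)) d≤n))

oneMinusQ-⊛-< : ∀ d g n → n ℕ.< d → (oneMinusQ d ⊛ g) n ≡ g n
oneMinusQ-⊛-< d g n n<d =
  trans (oneMinusQ-⊛ d g n) (trans (cong₂ _-_ (sumTo-monomial-in n 0 (λ i → g (n ∸ i)) z≤n)
                                               (sumTo-monomial-out n d (λ i → g (n ∸ i)) n<d))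
                                   (ℤP.+-identityʳ (g n)))

invOneMinusQ-0 : ∀ d → invOneMinusQ d 0 ≡ + 1
invOneMinusQ-0 d with d ∣? 0
... | yes _  = refl
... | no d∤0 = contradiction (d ℕD.∣0) d∤0

invOneMinusQ-gap : ∀ d n → 0 ℕ.< n → n ℕ.< d → invOneMinusQ d n ≡ + 0
invOneMinusQ-gap d n 0<n n<d with d ∣? n
... | no  _   = refl
... | yes d∣n = contradiction (ℕD.∣⇒≤ ⦃ ℕ.>-nonZero 0<n ⦄ d∣n) (ℕP.<⇒≱ n<d)

invOneMinusQ-period : ∀ d n → d ℕ.≤ n → invOneMinusQ d n ≡ invOneMinusQ d (n ∸ d)
invOneMinusQ-period d n d≤n with d ∣? n | d ∣? (n ∸ d)
... | yes _   | yes _     = refl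
... | no  _   | no  _     = refl
... | yes d∣n | no  d∤n-d =
  contradiction (ℕD.∣m+n∣m⇒∣n (subst (d ℕD.∣_) (sym (ℕP.m+[n∸m]≡n d≤n)) d∣n) ℕD.∣-refl) d∤n-d
... | no  d∤n | yes d∣n-d = contradiction (ℕD.∣m∸n∣n⇒∣m d d≤n d∣n-d ℕD.∣-refl) d∤n

oneMinusQ-inverse : ∀ d → 0 ℕ.< d → oneMinusQ d ⊛ invOneMinusQ d ≈ one
oneMinusQ-inverse d 0<d = coeffwise coeff
  where
  coeff : ∀ n → (oneMinusQ d ⊛ invOneMinusQ d) n ≡ one n
  coeff zero    = trans (oneMinusQ-⊛-< d (invOneMinusQ d) 0 0<d) (invOneMinusQ-0 d)
  coeff (suc n) with d ℕ.≤? suc n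
  ... | yes d≤n = trans (oneMinusQ-⊛-≥ d (invOneMinusQ d) (suc n) d≤n)
                        (trans (cong (_- invOneMinusQ d (suc n ∸ d)) (invOneMinusQ-period d (suc n) d≤n))
                               (ℤP.+-inverseʳ (invOneMinusQ d (suc n ∸ d))))
  ... | no  d≰n = trans (oneMinusQ-⊛-< d (invOneMinusQ d) (suc n) (ℕP.≰⇒> d≰n))
                        (invOneMinusQ-gap d (suc n) (s≤s z≤n) (ℕP.≰⇒> d≰n))

^ˢ-of-one : ∀ {f} → f ≈ one → ∀ k → f ^ˢ k ≈ one
^ˢ-of-one f≈one zero    = ≈-refl
^ˢ-of-one f≈one (suc k) = ≈-trans (⊛-cong f≈one (^ˢ-of-one f≈one k)) (⊛-identityˡ one)

eulerFactor : ℕ → Series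
eulerFactor m = oneMinusQ m ⊛ invOneMinusQ (2 ℕ.* m)

eulerProd : ℕ → Series
eulerProd zero    = one
eulerProd (suc N) = eulerProd N ⊛ eulerFactor (suc N)

-- The finite product in the theorem is the 24-th power of the Euler product.
-- (Bases of 24-th powers are only ever identified through ^ˢ-cong: letting the
-- type checker compare two unfolded 24-fold convolutions is exponentially slow.)
prodUpTo-as-power : ∀ N → prodUpTo N ≈ eulerProd N ^ˢ 24
prodUpTo-as-power zero    = ≈-sym (^ˢ-of-one {eulerProd zero} ≈-refl 24)
prodUpTo-as-power (suc N) = begin
  prodUpTo N ⊛ factor (suc N)
    ≈⟨ ⊛-congˡ (factor (suc N)) (prodUpTo-as-power N) ⟩
  (eulerProd N ^ˢ 24) ⊛ ((oneMinusQ (suc N) ^ˢ 24) ⊛ (invOneMinusQ (2 ℕ.* suc N) ^ˢ 24))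
    ≈⟨ ⊛-congʳ (eulerProd N ^ˢ 24) (^ˢ-distrib-⊛ (oneMinusQ (suc N)) (invOneMinusQ (2 ℕ.* suc N)) 24) ⟨
  (eulerProd N ^ˢ 24) ⊛ ((oneMinusQ (suc N) ⊛ invOneMinusQ (2 ℕ.* suc N)) ^ˢ 24)
    ≈⟨ ^ˢ-distrib-⊛ (eulerProd N) (oneMinusQ (suc N) ⊛ invOneMinusQ (2 ℕ.* suc N)) 24 ⟨
  (eulerProd N ⊛ (oneMinusQ (suc N) ⊛ invOneMinusQ (2 ℕ.* suc N))) ^ˢ 24
    ≈⟨ ^ˢ-cong {eulerProd N ⊛ (oneMinusQ (suc N) ⊛ invOneMinusQ (2 ℕ.* suc N))} {eulerProd (suc N)} 24 ≈-refl ⟩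
  eulerProd (suc N) ^ˢ 24 ∎
  where open ≈-Reasoning

oddProd : ℕ → Series
oddProd zero    = one
oddProd (suc K) = oddProd K ⊛ oneMinusQ (suc (K ℕ.+ K))

evenInvProd : ℕ → ℕ → Series
evenInvProd a zero    = one
evenInvProd a (suc l) = evenInvProd a l ⊛ invOneMinusQ (2 ℕ.* suc (a ℕ.+ l))

evenInvProd-lowest : ∀ a l → evenInvProd a (suc l) ≈ invOneMinusQ (2 ℕ.* suc a) ⊛ evenInvProd (suc a) l
evenInvProd-lowest a zero = begin
  one ⊛ invOneMinusQ (2 ℕ.* suc (a ℕ.+ 0)) ≈⟨ ⊛-identityˡ (invOneMinusQ (2 ℕ.* suc (a ℕ.+ 0))) ⟩
  invOneMinusQ (2 ℕ.* suc (a ℕ.+ 0))       ≡⟨ cong (λ k → invOneMinusQ (2 ℕ.* suc k)) (ℕP.+-identityʳ a) ⟩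
  invOneMinusQ (2 ℕ.* suc a)               ≈⟨ ⊛-identityʳ (invOneMinusQ (2 ℕ.* suc a)) ⟨
  invOneMinusQ (2 ℕ.* suc a) ⊛ one         ∎
  where open ≈-Reasoning
evenInvProd-lowest a (suc l) = begin
  evenInvProd a (suc l) ⊛ invOneMinusQ (2 ℕ.* suc (a ℕ.+ suc l))
    ≈⟨ ⊛-cong (evenInvProd-lowest a l) (≡⇒≈ (cong (λ k → invOneMinusQ (2 ℕ.* suc k)) (ℕP.+-suc a l))) ⟩
  (invOneMinusQ (2 ℕ.* suc a) ⊛ evenInvProd (suc a) l) ⊛ invOneMinusQ (2 ℕ.* suc (suc a ℕ.+ l))
    ≈⟨ ⊛-assoc (invOneMinusQ (2 ℕ.* suc a)) (evenInvProd (suc a) l) (invOneMinusQ (2 ℕ.* suc (suc a ℕ.+ l))) ⟩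
  invOneMinusQ (2 ℕ.* suc a) ⊛ evenInvProd (suc a) (suc l) ∎
  where open ≈-Reasoning

double-suc : ∀ K → 2 ℕ.* suc K ≡ suc (suc (K ℕ.+ K))
double-suc K = cong suc (trans (cong (K ℕ.+_) (ℕP.+-identityʳ (suc K))) (ℕP.+-suc K K))

-- The finite Euler identity: in the first 2K (resp. 2K+1) Euler factors the
-- numerators 1 - q^{2m} (m ≤ K) cancel the denominators of the first K
-- factors, leaving the odd numerators and the upper half of the denominators.
eulerProd-even : ∀ K → eulerProd (K ℕ.+ K) ≈ oddProd K ⊛ evenInvProd K K
eulerProd-odd  : ∀ K → eulerProd (suc (K ℕ.+ K)) ≈ oddProd (suc K) ⊛ evenInvProd K (suc K)

eulerProd-odd K = begin
  eulerProd (K ℕ.+ K) ⊛ (oneMinusQ (suc (K ℕ.+ K)) ⊛ J)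
    ≈⟨ ⊛-congˡ (oneMinusQ (suc (K ℕ.+ K)) ⊛ J) (eulerProd-even K) ⟩
  (oddProd K ⊛ evenInvProd K K) ⊛ (oneMinusQ (suc (K ℕ.+ K)) ⊛ J)
    ≈⟨ interchange (oddProd K) (evenInvProd K K) (oneMinusQ (suc (K ℕ.+ K))) J ⟩
  oddProd (suc K) ⊛ evenInvProd K (suc K) ∎
  where
  open ≈-Reasoning
  J : Series
  J = invOneMinusQ (2 ℕ.* suc (K ℕ.+ K))

eulerProd-even zero    = ≈-sym (⊛-identityˡ one)
eulerProd-even (suc K) = begin
  eulerProd (suc (K ℕ.+ suc K))
    ≡⟨ cong (λ m → eulerProd (suc m)) (ℕP.+-suc K K) ⟩
  eulerProd (suc (K ℕ.+ K)) ⊛ (oneMinusQ (suc (suc (K ℕ.+ K))) ⊛ J)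
    ≈⟨ ⊛-congˡ (oneMinusQ (suc (suc (K ℕ.+ K))) ⊛ J) (eulerProd-odd K) ⟩
  (O ⊛ evenInvProd K (suc K)) ⊛ (oneMinusQ (suc (suc (K ℕ.+ K))) ⊛ J)
    ≈⟨ ⊛-congˡ (oneMinusQ (suc (suc (K ℕ.+ K))) ⊛ J) (⊛-congʳ O (evenInvProd-lowest K K)) ⟩
  (O ⊛ (I ⊛ evenInvProd (suc K) K)) ⊛ (oneMinusQ (suc (suc (K ℕ.+ K))) ⊛ J)
    ≈⟨ rearrange O I (evenInvProd (suc K) K) (oneMinusQ (suc (suc (K ℕ.+ K)))) J ⟩
  (O ⊛ evenInvProd (suc K) (suc K)) ⊛ (oneMinusQ (suc (suc (K ℕ.+ K))) ⊛ I)
    ≈⟨ ⊛-congʳ (O ⊛ evenInvProd (suc K) (suc K)) cancel ⟩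
  (O ⊛ evenInvProd (suc K) (suc K)) ⊛ one
    ≈⟨ ⊛-identityʳ (O ⊛ evenInvProd (suc K) (suc K)) ⟩
  O ⊛ evenInvProd (suc K) (suc K) ∎
  where
  open ≈-Reasoning
  O I J : Series
  O = oddProd (suc K)
  I = invOneMinusQ (2 ℕ.* suc K)
  J = invOneMinusQ (2 ℕ.* suc (suc (K ℕ.+ K)))
  cancel : oneMinusQ (suc (suc (K ℕ.+ K))) ⊛ I ≈ one
  cancel = subst (λ d → oneMinusQ d ⊛ I ≈ one) (double-suc K) (oneMinusQ-inverse (2 ℕ.* suc K) (s≤s z≤n))
  rearrange : ∀ o i r m j → (o ⊛ (i ⊛ r)) ⊛ (m ⊛ j) ≈ (o ⊛ (r ⊛ j)) ⊛ (m ⊛ i)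
  rearrange o i r m j = prove 5 ((x ⊕ (y ⊕ z)) ⊕ (u ⊕ w)) ((x ⊕ (z ⊕ w)) ⊕ (u ⊕ y)) (o ∷ i ∷ r ∷ m ∷ j ∷ [])
    where
    open ⊛-Solver
    x = var zero; y = var (suc zero); z = var (suc (suc zero))
    u = var (suc (suc (suc zero))); w = var (suc (suc (suc (suc zero))))

even-or-odd : ∀ n → ∃ λ j → n ≡ j ℕ.+ j ⊎ n ≡ suc (j ℕ.+ j)
even-or-odd zero = 0 , inj₁ refl
even-or-odd (suc n) with even-or-odd n
... | j , inj₁ refl = j , inj₂ refl
... | j , inj₂ refl = suc j , inj₁ (cong suc (sym (ℕP.+-suc j j)))

eulerProd-shape : ∀ N → ∃ λ K → ∃ λ a → ∃ λ l →
  N ℕ.≤ K ℕ.+ K × eulerProd N ≈ oddProd K ⊛ evenInvProd a l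
eulerProd-shape N with even-or-odd N
... | K , inj₁ refl = K , K , K , ℕP.≤-refl , eulerProd-even K
... | K , inj₂ refl = suc K , K , suc K , ℕP.≤-trans (ℕP.n≤1+n _) (ℕP.≤-reflexive (cong suc (sym (ℕP.+-suc K K))))
                    , eulerProd-odd K

altSign : ℕ → ℤ
altSign n = -1ℤ ^ n

altSign-+ : ∀ m n → altSign (m ℕ.+ n) ≡ altSign m * altSign n
altSign-+ = ℤP.^-distribˡ-+-* -1ℤ

altSign-even : ∀ m → altSign (2 ℕ.* m) ≡ + 1
altSign-even m = trans (sym (ℤP.^-*-assoc -1ℤ 2 m)) (ℤP.^-zeroˡ m)

altSign-odd : ∀ K → altSign (suc (K ℕ.+ K)) ≡ -1ℤ
altSign-odd K = cong (-1ℤ *_) (trans (cong altSign (cong (K ℕ.+_) (sym (ℕP.+-identityʳ K)))) (altSign-even K))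

twist : Series → Series
twist f n = altSign n * f n

twist-cong : ∀ {f g} → f ≈ g → twist f ≈ twist g
twist-cong f≈g = coeffwise λ n → cong (altSign n *_) (app f≈g n)

twist-⊛ : ∀ f g → twist (f ⊛ g) ≈ twist f ⊛ twist g
twist-⊛ f g = coeffwise λ n → trans (sumTo-*ˡ n (altSign n) _) (sumTo-cong n λ i i≤n →
  trans (cong (_* (f i * g (n ∸ i)))
              (trans (cong altSign (sym (ℕP.m+[n∸m]≡n i≤n))) (altSign-+ i (n ∸ i))))
        (regroup (altSign i) (altSign (n ∸ i)) (f i) (g (n ∸ i))))
  where
  regroup : ∀ a b x y → a * b * (x * y) ≡ a * x * (b * y)
  regroup = solve-∀

twist-one : twist one ≈ one
twist-one = coeffwise λ { zero → refl ; (suc n) → ℤP.*-zeroʳ (altSign (suc n)) }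

twist-^ˢ : ∀ f k → twist (f ^ˢ k) ≈ twist f ^ˢ k
twist-^ˢ f zero    = twist-one
twist-^ˢ f (suc k) = ≈-trans (twist-⊛ f (f ^ˢ k)) (⊛-congʳ (twist f) (twist-^ˢ f k))

-- Σ_j q^{2mj} only involves even powers, so it is fixed by q ↦ -q.
twist-invOneMinusQ-even : ∀ m → twist (invOneMinusQ (2 ℕ.* m)) ≈ invOneMinusQ (2 ℕ.* m)
twist-invOneMinusQ-even m = coeffwise coeff
  where
  coeff : ∀ n → altSign n * invOneMinusQ (2 ℕ.* m) n ≡ invOneMinusQ (2 ℕ.* m) n
  coeff n with (2 ℕ.* m) ∣? n
  ... | no  _              = ℤP.*-zeroʳ (altSign n)
  ... | yes (divides j n≡j*2m) = cong (_* + 1) (trans (cong altSign n≡2mj) (altSign-even (m ℕ.* j)))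
    where
    n≡2mj : n ≡ 2 ℕ.* (m ℕ.* j)
    n≡2mj = trans n≡j*2m (trans (ℕP.*-comm j (2 ℕ.* m)) (ℕP.*-assoc 2 m j))

onePlusQ : ℕ → Series
onePlusQ d n = monomial 0 n + monomial d n

twist-oneMinusQ-odd : ∀ K → twist (oneMinusQ (suc (K ℕ.+ K))) ≈ onePlusQ (suc (K ℕ.+ K))
twist-oneMinusQ-odd K = coeffwise coeff
  where
  d : ℕ
  d = suc (K ℕ.+ K)
  coeff : ∀ n → altSign n * (monomial 0 n - monomial d n) ≡ monomial 0 n + monomial d n
  coeff zero = refl
  coeff (suc n) with suc n ℕ.≟ d
  ... | yes refl = begin
    altSign d * (+ 0 - monomial d d) ≡⟨ cong₂ (λ s x → s * (+ 0 - x)) (altSign-odd K) (monomial-≡ d) ⟩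
    + 1                              ≡⟨ cong (λ x → + 0 + x) (monomial-≡ d) ⟨
    + 0 + monomial d d               ∎
    where open ≡-Reasoning
  ... | no 1+n≢d = begin
    altSign (suc n) * (+ 0 - monomial d (suc n)) ≡⟨ cong (λ x → altSign (suc n) * (+ 0 - x)) (monomial-≢ 1+n≢d) ⟩
    altSign (suc n) * + 0                        ≡⟨ ℤP.*-zeroʳ (altSign (suc n)) ⟩
    + 0                                          ≡⟨ cong (λ x → + 0 + x) (monomial-≢ 1+n≢d) ⟨
    + 0 + monomial d (suc n)                     ∎
    where open ≡-Reasoning

oddPlusProd : ℕ → Series
oddPlusProd zero    = one
oddPlusProd (suc K) = oddPlusProd K ⊛ onePlusQ (suc (K ℕ.+ K))

twist-oddProd : ∀ K → twist (oddProd K) ≈ oddPlusProd K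
twist-oddProd zero    = twist-one
twist-oddProd (suc K) = ≈-trans (twist-⊛ (oddProd K) (oneMinusQ (suc (K ℕ.+ K))))
                                (⊛-cong (twist-oddProd K) (twist-oneMinusQ-odd K))

twist-evenInvProd : ∀ a l → twist (evenInvProd a l) ≈ evenInvProd a l
twist-evenInvProd a zero    = twist-one
twist-evenInvProd a (suc l) = ≈-trans (twist-⊛ (evenInvProd a l) (invOneMinusQ (2 ℕ.* suc (a ℕ.+ l))))
                                      (⊛-cong (twist-evenInvProd a l) (twist-invOneMinusQ-even (suc (a ℕ.+ l))))

-- After q ↦ -q, the 24-th root of the N-th partial product becomes
-- ∏ (1 + q^{2j+1}) · ∏ 1/(1 - q^{2m}), which has no negative coefficients.
twist-prodUpTo : ∀ N K a l → eulerProd N ≈ oddProd K ⊛ evenInvProd a l →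
  twist (prodUpTo N) ≈ (oddPlusProd K ⊛ evenInvProd a l) ^ˢ 24
twist-prodUpTo N K a l shape = begin
  twist (prodUpTo N)            ≈⟨ twist-cong (prodUpTo-as-power N) ⟩
  twist (eulerProd N ^ˢ 24)     ≈⟨ twist-^ˢ (eulerProd N) 24 ⟩
  twist (eulerProd N) ^ˢ 24     ≈⟨ ^ˢ-cong {twist (eulerProd N)} {oddPlusProd K ⊛ evenInvProd a l} 24 twisted ⟩
  (oddPlusProd K ⊛ evenInvProd a l) ^ˢ 24 ∎
  where
  open ≈-Reasoning
  twisted : twist (eulerProd N) ≈ oddPlusProd K ⊛ evenInvProd a l
  twisted = ≈-trans (twist-cong shape) (≈-trans (twist-⊛ (oddProd K) (evenInvProd a l))
                                                (⊛-cong (twist-oddProd K) (twist-evenInvProd a l)))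

record Nonneg (f : Series) : Set where
  field nonneg : ∀ n → + 0 ≤ f n
open Nonneg

record NonnegUnit (f : Series) : Set where
  field
    isNonneg : Nonneg f
    unit     : + 1 ≤ f 0
open NonnegUnit

≤-+-nonneg : ∀ x {y} → + 0 ≤ y → x ≤ x + y
≤-+-nonneg x 0≤y = subst (_≤ x + _) (ℤP.+-identityʳ x) (ℤP.+-mono-≤ (ℤP.≤-refl {x}) 0≤y)

nonneg-* : ∀ {x y} → + 0 ≤ x → + 0 ≤ y → + 0 ≤ x * y
nonneg-* {+ m} {+ k} _ _ = subst (+ 0 ≤_) (ℤP.pos-* m k) (+≤+ z≤n)

≥1-* : ∀ {x y} → + 1 ≤ x → + 1 ≤ y → + 1 ≤ x * y
≥1-* {+ suc m} {+ suc k} (+≤+ (s≤s _)) (+≤+ (s≤s _)) = subst (+ 1 ≤_) (ℤP.pos-* (suc m) (suc k)) (+≤+ (s≤s z≤n))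

indicator-nonneg : ∀ b → + 0 ≤ (if b then + 1 else + 0)
indicator-nonneg true  = +≤+ z≤n
indicator-nonneg false = +≤+ z≤n

sumTo-nonneg : ∀ n (F : ℕ → ℤ) → (∀ i → + 0 ≤ F i) → + 0 ≤ sumTo n F
sumTo-nonneg zero    F F≥0 = F≥0 0
sumTo-nonneg (suc n) F F≥0 = ℤP.+-mono-≤ (sumTo-nonneg n F F≥0) (F≥0 (suc n))

sumTo-≥-term : ∀ n (F : ℕ → ℤ) → (∀ i → + 0 ≤ F i) → ∀ i → i ℕ.≤ n → F i ≤ sumTo n F
sumTo-≥-term zero    F F≥0 .zero z≤n = ℤP.≤-refl
sumTo-≥-term (suc n) F F≥0 i    i≤1+n with ℕP.m≤n⇒m<n∨m≡n i≤1+n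
... | inj₁ i<1+n = ℤP.≤-trans (sumTo-≥-term n F F≥0 i (ℕP.≤-pred i<1+n)) (≤-+-nonneg (sumTo n F) (F≥0 (suc n)))
... | inj₂ refl  = subst (_≤ sumTo n F + F (suc n)) (ℤP.+-identityˡ (F (suc n)))
                         (ℤP.+-mono-≤ (sumTo-nonneg n F F≥0) (ℤP.≤-refl {F (suc n)}))

Nonneg-⊛ : ∀ {f g} → Nonneg f → Nonneg g → Nonneg (f ⊛ g)
Nonneg-⊛ f≥0 g≥0 = record { nonneg = λ n →
  sumTo-nonneg n _ (λ i → nonneg-* (nonneg f≥0 i) (nonneg g≥0 (n ∸ i))) }

⊛-coeff-≥1 : ∀ {f g} → Nonneg f → Nonneg g → ∀ n i → i ℕ.≤ n →
  + 1 ≤ f i → + 1 ≤ g (n ∸ i) → + 1 ≤ (f ⊛ g) n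
⊛-coeff-≥1 f≥0 g≥0 n i i≤n fi≥1 gn-i≥1 = ℤP.≤-trans (≥1-* fi≥1 gn-i≥1)
  (sumTo-≥-term n _ (λ j → nonneg-* (nonneg f≥0 j) (nonneg g≥0 (n ∸ j))) i i≤n)

⊛-keepsˡ : ∀ {f g} n → NonnegUnit f → NonnegUnit g → + 1 ≤ f n → + 1 ≤ (f ⊛ g) n
⊛-keepsˡ {g = g} n uf ug fn≥1 = ⊛-coeff-≥1 (isNonneg uf) (isNonneg ug) n n ℕP.≤-refl fn≥1
  (subst (λ m → + 1 ≤ g m) (sym (ℕP.n∸n≡0 n)) (unit ug))

⊛-keepsʳ : ∀ {f g} n → NonnegUnit f → NonnegUnit g → + 1 ≤ g n → + 1 ≤ (f ⊛ g) n
⊛-keepsʳ n uf ug gn≥1 = ⊛-coeff-≥1 (isNonneg uf) (isNonneg ug) n 0 z≤n (unit uf) gn≥1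

NonnegUnit-⊛ : ∀ {f g} → NonnegUnit f → NonnegUnit g → NonnegUnit (f ⊛ g)
NonnegUnit-⊛ uf ug = record { isNonneg = Nonneg-⊛ (isNonneg uf) (isNonneg ug) ; unit = ⊛-keepsʳ 0 uf ug (unit ug) }

NonnegUnit-one : NonnegUnit one
NonnegUnit-one = record { isNonneg = record { nonneg = λ { zero → +≤+ z≤n ; (suc _) → +≤+ z≤n } }
                        ; unit = ℤP.≤-refl }

NonnegUnit-^ˢ : ∀ {f} → NonnegUnit f → ∀ k → NonnegUnit (f ^ˢ k)
NonnegUnit-^ˢ uf zero    = NonnegUnit-one
NonnegUnit-^ˢ uf (suc k) = NonnegUnit-⊛ uf (NonnegUnit-^ˢ uf k)

NonnegUnit-invOneMinusQ : ∀ d → NonnegUnit (invOneMinusQ d)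
NonnegUnit-invOneMinusQ d = record
  { isNonneg = record { nonneg = λ n → indicator-nonneg (does (d ∣? n)) }
  ; unit     = ℤP.≤-reflexive (sym (invOneMinusQ-0 d)) }

NonnegUnit-onePlusQ : ∀ d → NonnegUnit (onePlusQ d)
NonnegUnit-onePlusQ d = record
  { isNonneg = record { nonneg = λ n → ℤP.+-mono-≤ (indicator-nonneg (does (n ℕ.≟ 0)))
                                                    (indicator-nonneg (does (n ℕ.≟ d))) }
  ; unit     = ≤-+-nonneg (+ 1) (indicator-nonneg (does (0 ℕ.≟ d))) }

NonnegUnit-oddPlusProd : ∀ K → NonnegUnit (oddPlusProd K)
NonnegUnit-oddPlusProd zero    = NonnegUnit-one
NonnegUnit-oddPlusProd (suc K) = NonnegUnit-⊛ (NonnegUnit-oddPlusProd K) (NonnegUnit-onePlusQ (suc (K ℕ.+ K)))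

NonnegUnit-evenInvProd : ∀ a l → NonnegUnit (evenInvProd a l)
NonnegUnit-evenInvProd a zero    = NonnegUnit-one
NonnegUnit-evenInvProd a (suc l) =
  NonnegUnit-⊛ (NonnegUnit-evenInvProd a l) (NonnegUnit-invOneMinusQ (2 ℕ.* suc (a ℕ.+ l)))

OddPositive : Series → ℕ → Set
OddPositive G K = ∀ j → j ℕ.< K → + 1 ≤ G (suc (j ℕ.+ j))

oddPlusProd-oddPositive : ∀ K → OddPositive (oddPlusProd K) K
oddPlusProd-oddPositive (suc K) j j<1+K with ℕP.m≤n⇒m<n∨m≡n (ℕP.≤-pred j<1+K)
... | inj₁ j<K = ⊛-keepsˡ (suc (j ℕ.+ j)) (NonnegUnit-oddPlusProd K) (NonnegUnit-onePlusQ (suc (K ℕ.+ K)))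
                          (oddPlusProd-oddPositive K j j<K)
... | inj₂ refl = ⊛-keepsʳ (suc (K ℕ.+ K)) (NonnegUnit-oddPlusProd K) (NonnegUnit-onePlusQ (suc (K ℕ.+ K)))
                           (ℤP.≤-reflexive (sym (cong (λ x → + 0 + x) (monomial-≡ (suc (K ℕ.+ K))))))

half-bound : ∀ j K → suc (j ℕ.+ j) ℕ.≤ K ℕ.+ K → j ℕ.< K
half-bound j K 2j+1≤2K with j ℕ.<? K
... | yes j<K = j<K
... | no  j≮K = contradiction (ℕP.≤-trans 2j+1≤2K (ℕP.+-mono-≤ (ℕP.≮⇒≥ j≮K) (ℕP.≮⇒≥ j≮K))) (ℕP.n≮n (j ℕ.+ j))

-- If G ≥ 0 has constant term and odd coefficients up to 2K at least 1, then
-- all coefficients of G² up to 2K are ≥ 1:  2j+2 = 1 + (2j+1)  and  2j+1 = 0 + (2j+1).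
square-≥1 : ∀ {G K} → NonnegUnit G → OddPositive G K → ∀ n → n ℕ.≤ K ℕ.+ K → + 1 ≤ (G ⊛ G) n
square-≥1 {G} {K} uG odd n n≤2K with even-or-odd n
... | zero  , inj₁ refl = ⊛-keepsʳ 0 uG uG (unit uG)
... | suc j , inj₁ refl = ⊛-coeff-≥1 (isNonneg uG) (isNonneg uG) (suc j ℕ.+ suc j) 1 (s≤s z≤n)
        (odd 0 (half-bound 0 K (ℕP.≤-trans (s≤s z≤n) n≤2K)))
        (subst (λ m → + 1 ≤ G m) (sym (ℕP.+-suc j j))
               (odd j (half-bound j K (ℕP.≤-trans (s≤s (ℕP.+-monoʳ-≤ j (ℕP.n≤1+n j))) n≤2K))))
... | j     , inj₂ refl = ⊛-keepsʳ (suc (j ℕ.+ j)) uG uG (odd j (half-bound j K n≤2K))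

power-≥1 : ∀ {G K} → NonnegUnit G → OddPositive G K → ∀ n → n ℕ.≤ K ℕ.+ K →
  ∀ k → 2 ℕ.≤ k → + 1 ≤ (G ^ˢ k) n
power-≥1 uG odd n n≤2K 1 (s≤s ())
power-≥1 {G} uG odd n n≤2K 2 _ =
  subst (+ 1 ≤_) (sym (app (⊛-congʳ G (⊛-identityʳ G)) n)) (square-≥1 uG odd n n≤2K)
power-≥1 uG odd n n≤2K (suc (suc (suc k))) _ =
  ⊛-keepsʳ n uG (NonnegUnit-^ˢ uG (suc (suc k))) (power-≥1 uG odd n n≤2K (suc (suc k)) (s≤s (s≤s z≤n)))

-- The N-th coefficient of the twisted N-th partial product is at least 1:
-- it is a coefficient of G^24 with G = ∏_{j<K} (1 + q^{2j+1}) · ∏ 1/(1 - q^{2m}),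
-- N ≤ 2K.
twist-prodUpTo-≥1 : ∀ N → + 1 ≤ twist (prodUpTo N) N
twist-prodUpTo-≥1 N with eulerProd-shape N
... | K , a , l , N≤2K , shape =
  subst (+ 1 ≤_) (sym (app (twist-prodUpTo N K a l shape) N))
    (power-≥1 uG oddG N N≤2K 24 (s≤s (s≤s z≤n)))
  where
  uG : NonnegUnit (oddPlusProd K ⊛ evenInvProd a l)
  uG = NonnegUnit-⊛ (NonnegUnit-oddPlusProd K) (NonnegUnit-evenInvProd a l)
  oddG : OddPositive (oddPlusProd K ⊛ evenInvProd a l) K
  oddG j j<K = ⊛-keepsˡ (suc (j ℕ.+ j)) (NonnegUnit-oddPlusProd K) (NonnegUnit-evenInvProd a l)
                        (oddPlusProd-oddPositive K j j<K)

-- Hence the coefficient of q^N in the product, which equals that of the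
-- N-th partial product, is ± (something ≥ 1).
prodCoeff-nonzero : ∀ N → prodCoeff N ≢ + 0
prodCoeff-nonzero N coeff≡0 = 1≰0 (subst (+ 1 ≤_) twisted≡0 (twist-prodUpTo-≥1 N))
  where
  twisted≡0 : twist (prodUpTo N) N ≡ + 0
  twisted≡0 = trans (cong (altSign N *_) coeff≡0) (ℤP.*-zeroʳ (altSign N))
  1≰0 : ¬ (+ 1 ≤ + 0)
  1≰0 (+≤+ ())

-- c n is by definition the coefficient of q^{|n+1|} in the product.
mainTheorem2 : (n : ℤ) → - (+ 1) ≤ n → c n ≢ + 0
mainTheorem2 n _ = prodCoeff-nonzero ℤ.∣ n + + 1 ∣
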